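{- Let $G=(A,B,E)$ be a finite bipartite graph of linearity $c\ge 1$, given together with $c$ as input to Algorithm 1 (described in the context). Then Algorithm 1 either returns "false" or returns a total order on $A$ whose crossing number (with respect to $G$) is at most $12c^2\log^2|A|$.
   Context: For a bipartite graph $G=(A,B,E)$ and subsets $A''\subseteq A$, $B''\subseteq B$, $G[A'',B'']$ is the induced subgraph. $N(v)$ denotes neighborhoods. For a total order on $A$ and $b\in B$, the crossing number with respect to $b$ is the number of pairs of consecutive elements $(a,a')$ with exactly one of $a,a'$ in $N(b)$; the crossing number of the order is the maximum over $b\in B$. Two vertices on the same side are twins (in a given graph) if they have the same neighborhood; the twin partition of a side is its partition into twin classes, and "with representatives" means one chosen vertex per class. Define $\pi_G(n)=\max_{A''\subseteq A,|A''|\le n}$ (number of twin classes of $B$ in $G[A'',B]$) and $\pi^*_G(n)=\max_{B''\subseteq B,|B''|\le n}$ (number of twin classes of $A$ in $G[A,B'']$). The linearity of $G$ is the smallest $c\ge1$ with $\pi_G(k),\pi^*_G(k)\le ck$ for all $k$. A partition $\{P_1,\dots,P_\ell\}$ of $B''$ with set $\{v_1,\dots,v_\ell\}$ is a $k$-near twin partition with representatives $\{v_1,\dots,v_\ell\}$ (in a given graph) if $v_i\in P_i$ and $|N(v)\triangle N(v_i)|\le k$ for every $v\in P_i$. Logarithms are base 2. Algorithm 1 (input $c\ge1$ and $G=(A,B,E)$ of linearity $c$; output a total order on $A$ or "false"): Set $A_{\mathrm{cur}}\gets A$, $B_{\mathrm{cur}}\gets B$, $L\gets$ empty stack. While $|A_{\mathrm{cur}}|>12c^2\log|A|$: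 (i) sample $W\subseteq A_{\mathrm{cur}}$ of size $\lceil|A_{\mathrm{cur}}|/(2c^2)\rceil$ uniformly at random; (ii) let $\mathcal{B}$ be the twin partition of $B_{\mathrm{cur}}$ in $G[W,B_{\mathrm{cur}}]$ with representatives $B'$, and let $\mathcal{A}$ be the twin partition of $A_{\mathrm{cur}}$ in $G[A_{\mathrm{cur}},B']$ with representatives $A'$; (iii) if $\mathcal{B}$ is not a $(6c^2\log|A|)$-near twin partition of $B_{\mathrm{cur}}$ in $G[A_{\mathrm{cur}},B_{\mathrm{cur}}]$ with representatives $B'$, return "false"; (iv) for each $v\in A_{\mathrm{cur}}\setminus A'$ with representative $v_{\mathrm{rep}}\in A'$ of its class in $\mathcal{A}$, push $(v,v_{\mathrm{rep}})$ onto $L$; (v) set $(A_{\mathrm{cur}},B_{\mathrm{cur}})\gets(A',B')$. After the loop, choose an arbitrary total order on $A_{\mathrm{cur}}$; then pop pairs $(v,v_{\mathrm{rep}})$ from $L$ in reverse insertion order and insert each $v$ directly after $v_{\mathrm{rep}}$ in the order; return the resulting order. -}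

module Defs where

open import Data.Bool using (Bool; true; false; _xor_; if_then_else_)
open import Data.Bool.Properties using () renaming (_≟_ to _≟ᵇ_)
open import Data.Nat using (ℕ; zero; suc; _+_; _*_; _^_; _≤_; _<_; _⊔_; _/_)
open import Data.Fin using (Fin; _≟_)
open import Data.Fin.Subset using (Subset; _∈_; _∉_; _⊆_; _∩_; _─_; ∣_∣; ⊤)
open import Data.Vec using (Vec; tabulate; zipWith)
open import Data.Vec.Properties using (≡-dec)
open import Data.List using (List; []; _∷_; length; map; deduplicate; foldl; foldr; reverse; _++_)
open import Data.List.Membership.Propositional using () renaming (_∈_ to _∈ˡ_)
open import Data.List.Relation.Unary.Unique.Propositional using (Unique)
open import Data.Product using (Σ; ∃; _×_; _,_)
open import Data.Empty using (⊥)
open import Relation.Nullary using (¬_)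
open import Relation.Binary.PropositionalEquality using (_≡_; _≢_)

-- A finite bipartite graph G = (A, B, E) with A = Fin n, B = Fin m,
-- given by its adjacency function E : Fin n → Fin m → Bool.

Graph : ℕ → ℕ → Set
Graph n m = Fin n → Fin m → Bool

module _ {n m : ℕ} (E : Graph n m) where

  NB : Fin m → Subset n
  NB b = tabulate (λ a → E a b)

  NA : Fin n → Subset m
  NA a = tabulate (λ b → E a b)

  twinClassesB : Subset n → ℕ
  twinClassesB A'' = length (deduplicate (≡-dec _≟ᵇ_) (map (λ b → A'' ∩ NB b) (Data.List.Base.allFin m)))
    where import Data.List.Base

  twinClassesA : Subset m → ℕ
  twinClassesA B'' = length (deduplicate (≡-dec _≟ᵇ_) (map (λ a → B'' ∩ NA a) (Data.List.Base.allFin n)))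
    where import Data.List.Base

  -- π_G(k) ≤ (p/q)·k  and  π*_G(k) ≤ (p/q)·k   (unfolding of the maxima)
  πBound : ℕ → ℕ → ℕ → Set
  πBound p q k = ∀ (A'' : Subset n) → ∣ A'' ∣ ≤ k → q * twinClassesB A'' ≤ p * k

  π*Bound : ℕ → ℕ → ℕ → Set
  π*Bound p q k = ∀ (B'' : Subset m) → ∣ B'' ∣ ≤ k → q * twinClassesA B'' ≤ p * k

  LinBound : ℕ → ℕ → Set
  LinBound p q = 0 < q × q ≤ p × (∀ k → 1 ≤ k → πBound p q k × π*Bound p q k)

  HasLinearity : ℕ → ℕ → Set
  HasLinearity p q = LinBound p q × (∀ p' q' → LinBound p' q' → p * q' ≤ p' * q)

  crossB : List (Fin n) → Fin m → ℕ
  crossB [] b = 0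
  crossB (a ∷ []) b = 0
  crossB (a ∷ a' ∷ as) b = (if E a b xor E a' b then 1 else 0) + crossB (a' ∷ as) b

  crossingNumber : List (Fin n) → ℕ
  crossingNumber O = foldr _⊔_ 0 (map (crossB O) (Data.List.Base.allFin m))
    where import Data.List.Base

  -- Algorithm 1, with c = p/q, modelled as a nondeterministic relation
  -- (all random / arbitrary choices are quantified over).

  -- The list O is a total order on the subset S (each element exactly once).
  Enumerates : Subset n → List (Fin n) → Set
  Enumerates S O = Unique O × (∀ v → (v ∈ S → v ∈ˡ O) × (v ∈ˡ O → v ∈ S))

  TwinB : Subset n → Fin m → Fin m → Set
  TwinB W b b' = W ∩ NB b ≡ W ∩ NB b'

  TwinA : Subset m → Fin n → Fin n → Set
  TwinA B' a a' = B' ∩ NA a ≡ B' ∩ NA a'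

  IsReps : {k : ℕ} → (Fin k → Fin k → Set) → Subset k → Subset k → Set
  IsReps {k} Tw S R = R ⊆ S × (∀ x → x ∈ S → Σ (Fin k) (λ r → r ∈ R × Tw x r))
                        × (∀ r r' → r ∈ R → r' ∈ R → Tw r r' → r ≡ r')

  symDiff : Subset n → Subset n → Subset n
  symDiff = zipWith _xor_

  ceilDiv : ℕ → ℕ → ℕ
  ceilDiv x zero = 0
  ceilDiv x (suc y) = (x + y) / suc y

  -- loop condition  |Acur| > 12 c² log |A|   ⇔  2^(|Acur| q²) > n^(12 p²)
  LoopCond : ℕ → ℕ → Subset n → Set
  LoopCond p q Acur = n ^ (12 * (p * p)) < 2 ^ (∣ Acur ∣ * (q * q))

  -- 𝓑 (reps B') is a (6c² log|A|)-near twin partition of Bcur in G[Acur,Bcur]: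
  -- for b ∈ Bcur with representative b', |N(b) △ N(b') ∩ Acur| ≤ 6 c² log n,
  -- i.e. 2^(d q²) ≤ n^(6 p²)
  NearTwinOK : ℕ → ℕ → Subset n → Subset m → Subset n → Subset m → Set
  NearTwinOK p q Acur Bcur W B' = ∀ b b' → b ∈ Bcur → b' ∈ B' → TwinB W b b' →
    2 ^ (∣ Acur ∩ symDiff (NB b) (NB b') ∣ * (q * q)) ≤ n ^ (6 * (p * p))

  -- pairs (v , v_rep) pushed in one round, in the order listed
  PushedOK : Subset n → Subset m → Subset n → List (Fin n × Fin n) → Set
  PushedOK Acur B' A' P =
    Enumerates (Acur ─ A') (map Data.Product.proj₁ P) ×
    (∀ v r → (v , r) ∈ˡ P → r ∈ A' × TwinA B' v r)

  insertAfter : Fin n → Fin n → List (Fin n) → List (Fin n)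
  insertAfter v r [] = []
  insertAfter v r (x ∷ xs) with x ≟ r
  ... | Relation.Nullary.yes _ = x ∷ v ∷ xs
  ... | Relation.Nullary.no _ = x ∷ insertAfter v r xs

  data Output : Set where
    false' : Output
    order  : List (Fin n) → Output

  -- Run p q Acur Bcur L out : from state (Acur, Bcur, stack L) some execution
  -- returns out.  Stack L is a list whose head is the top.
  data Run (p q : ℕ) : Subset n → Subset m → List (Fin n × Fin n) → Output → Set where
    finish : ∀ {Acur Bcur L} (O₀ : List (Fin n)) →
      ¬ LoopCond p q Acur → Enumerates Acur O₀ →
      Run p q Acur Bcur L (order (foldl (λ O vr → insertAfter (Data.Product.proj₁ vr) (Data.Product.proj₂ vr) O) O₀ L))
    fail : ∀ {Acur Bcur L} (W : Subset n) (B' : Subset m) (A' : Subset n) →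
      LoopCond p q Acur →
      W ⊆ Acur → ∣ W ∣ ≡ ceilDiv (∣ Acur ∣ * (q * q)) (2 * (p * p)) →
      IsReps (TwinB W) Bcur B' → IsReps (TwinA B') Acur A' →
      ¬ NearTwinOK p q Acur Bcur W B' →
      Run p q Acur Bcur L false'
    step : ∀ {Acur Bcur L out} (W : Subset n) (B' : Subset m) (A' : Subset n)
      (P : List (Fin n × Fin n)) →
      LoopCond p q Acur →
      W ⊆ Acur → ∣ W ∣ ≡ ceilDiv (∣ Acur ∣ * (q * q)) (2 * (p * p)) →
      IsReps (TwinB W) Bcur B' → IsReps (TwinA B') Acur A' →
      NearTwinOK p q Acur Bcur W B' →
      PushedOK Acur B' A' P →
      Run p q A' B' (reverse P ++ L) out →
      Run p q Acur Bcur L out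

  -- x ≤ 12 c² log² n   (c = p/q),  stated without reals:
  -- for every rational t = a/b ≥ 0 with t² ≤ x q² / (12 p²) we have t ≤ log n,
  -- i.e. 2^a ≤ n^b.
  LogSqBound : ℕ → ℕ → ℕ → Set
  LogSqBound p q x = ∀ a b → 0 < b → 12 * (p * p) * (a * a) ≤ x * (q * q) * (b * b) → 2 ^ a ≤ n ^ b

-- Replaying the stack inserts every removed vertex v directly after its representative r, which
-- is a twin of v with respect to the next set B'; so for b' ∈ B' the insertions create no new
-- crossings. Every b ∈ Bcur is a (6c² log n)-near twin of its representative b', and a vertex on
-- which N(b) and N(b') disagree lies in at most two consecutive pairs, so each round adds at most
-- 12c² log n to the crossing number with respect to b. The innermost arbitrary order has at most
-- |Acur| ≤ 12c² log n crossings. By linearity |A'| ≤ c²|W| < |Acur|/2 + c², while the loop only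
-- runs when |Acur| > 12c² log n; hence t rounds force 2^(t+1) ≤ n, and the crossing number is
-- at most (t + 1) · 12c² log n ≤ 12c² log² n.
module Submission where

open import Defs
open import Data.Nat using (ℕ)
open import Data.Fin.Subset using (⊤)
open import Data.List using (List; [])
open import Data.Fin using (Fin)
open import Data.Product using (Σ; _×_)
open import Data.Sum using (_⊎_)
open import Relation.Binary.PropositionalEquality using (_≡_)

open import Data.Bool using (Bool; true; false; _xor_; _∧_; if_then_else_)
open import Data.Bool.Properties using (xor-same) renaming (_≟_ to _≟ᵇ_)
open import Data.Empty using (⊥)
open import Data.Fin using (_≟_)
open import Data.Fin.Properties using (any?)
open import Data.Fin.Subset using (Subset; _∈_; _∉_; _⊆_; _∩_; _─_; _-_; ∣_∣; ⁅_⁆; inside; outside)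
open import Data.Fin.Subset.Properties
  using ( ∈⊤; ∣⊤∣≡n; _∈?_; x∈p∧x∉q⇒x∈p─q; x∈p∧x≢y⇒x∈p-y; x∈p⇒∣p-x∣<∣p∣; p─q⊆p; x∉⁅y⁆⇒x≢y; ∣⁅x⁆∣≡1
        ; Empty-unique; ∣⊥∣≡0; x∈p∩q⁺)
open import Data.List using (_∷_; _++_; length; map; foldr; foldl; reverse; drop; allFin; deduplicate)
open import Data.List.Properties using (reverse-foldr; reverse-involutive; foldl-++; foldr-preservesᵇ)
open import Data.List.Membership.Propositional using () renaming (_∈_ to _∈ˡ_)
open import Data.List.Membership.Propositional.Properties
  using (∈-map⁺; ∈-allFin; ∈-deduplicate⁺; ∈-++⁺ˡ; ∈-++⁺ʳ; ∈-++⁻)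
open import Data.List.Relation.Unary.Any using (here; there)
import Data.List.Relation.Unary.All as All
import Data.List.Relation.Unary.All.Properties as All
open import Data.List.Relation.Unary.AllPairs using (_∷_)
open import Data.List.Relation.Unary.Unique.Propositional using (Unique)
import Data.List.Relation.Unary.Unique.Propositional.Properties as Unique
open import Data.List.Relation.Binary.Permutation.Propositional
  using (_↭_; prep; swap; ↭-refl; ↭-trans; ↭-sym; ↭⇒↭ₛ)
open import Data.List.Relation.Binary.Permutation.Propositional.Properties using (∈-resp-↭)
import Data.List.Relation.Binary.Permutation.Setoid.Properties as Perm
open import Data.Nat using (suc; zero; _+_; _*_; _^_; _⊔_; _≤_; _<_; z≤n; s≤s; _≤?_; NonZero; >-nonZero)
open import Data.Nat.DivMod using (_/_; m/n*n≤m; m≥n⇒m/n>0)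
open import Data.Nat.Properties hiding (_≟_)
open import Data.Nat.Tactic.RingSolver using (solve-∀)
open import Data.Product using (_,_; proj₁; proj₂)
open import Data.Sum using (inj₁; inj₂)
import Data.Vec as Vec
open import Data.Vec using (_∷_; [])
open import Data.Vec.Properties using (≡-dec; lookup-zipWith; lookup∘tabulate; []=⇒lookup; lookup⇒[]=)
open import Function using (_∘_)
open import Relation.Binary using (DecidableEquality)
open import Relation.Binary.PropositionalEquality
  using (refl; sym; trans; cong; cong₂; subst; setoid; module ≡-Reasoning)
open import Relation.Nullary using (¬_; yes; no; contradiction)
open import Relation.Nullary.Decidable using (_×-dec_)

x∈p─q⇒x∉q : ∀ {k} {x : Fin k} (p q : Subset k) → x ∈ p ─ q → x ∉ q
x∈p─q⇒x∉q (_ ∷ p) (inside ∷ q) () Vec.here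
x∈p─q⇒x∉q (_ ∷ p) (_ ∷ q) (Vec.there x∈p─q) (Vec.there x∈q) = x∈p─q⇒x∉q p q x∈p─q x∈q

∣p∣≤∣p─q∣+∣q∣ : ∀ {k} (p q : Subset k) → ∣ p ∣ ≤ ∣ p ─ q ∣ + ∣ q ∣
∣p∣≤∣p─q∣+∣q∣ [] [] = z≤n
∣p∣≤∣p─q∣+∣q∣ (inside ∷ p) (inside ∷ q) =
  subst (suc ∣ p ∣ ≤_) (sym (+-suc _ _)) (s≤s (∣p∣≤∣p─q∣+∣q∣ p q))
∣p∣≤∣p─q∣+∣q∣ (inside ∷ p) (outside ∷ q) = s≤s (∣p∣≤∣p─q∣+∣q∣ p q)
∣p∣≤∣p─q∣+∣q∣ (outside ∷ p) (inside ∷ q) =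
  ≤-trans (∣p∣≤∣p─q∣+∣q∣ p q) (≤-trans (n≤1+n _) (≤-reflexive (sym (+-suc _ _))))
∣p∣≤∣p─q∣+∣q∣ (outside ∷ p) (outside ∷ q) = ∣p∣≤∣p─q∣+∣q∣ p q

∣p∣≤1+∣p-x∣ : ∀ {k} (p : Subset k) x → ∣ p ∣ ≤ suc ∣ p - x ∣
∣p∣≤1+∣p-x∣ p x = begin
  ∣ p ∣                 ≤⟨ ∣p∣≤∣p─q∣+∣q∣ p ⁅ x ⁆ ⟩
  ∣ p - x ∣ + ∣ ⁅ x ⁆ ∣ ≡⟨ cong (∣ p - x ∣ +_) (∣⁅x⁆∣≡1 x) ⟩
  ∣ p - x ∣ + 1         ≡⟨ +-comm ∣ p - x ∣ 1 ⟩
  suc ∣ p - x ∣         ∎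
  where open ≤-Reasoning

injection⇒∣p∣≤length : ∀ {k} {X : Set} → DecidableEquality X → (f : Fin k → X) (R : Subset k) (D : List X) →
  (∀ r r' → r ∈ R → r' ∈ R → f r ≡ f r' → r ≡ r') → (∀ {r} → r ∈ R → f r ∈ˡ D) → ∣ R ∣ ≤ length D
injection⇒∣p∣≤length {k} _ f R [] _ into = ≤-reflexive (subst (λ S → ∣ S ∣ ≡ 0) (sym R≡⊥) (∣⊥∣≡0 k))
  where
    ∉[] : ∀ {x} → x ∈ˡ [] → ⊥
    ∉[] ()
    R≡⊥ = Empty-unique λ (r , r∈R) → ∉[] (into r∈R)
injection⇒∣p∣≤length _≟X_ f R (d ∷ D) inj into with any? (λ r → (r ∈? R) ×-dec (f r ≟X d))
... | yes (r₀ , r₀∈R , fr₀≡d) =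
  ≤-trans (∣p∣≤1+∣p-x∣ R r₀) (s≤s (injection⇒∣p∣≤length _≟X_ f (R - r₀) D inj′ into′))
  where
    R-r₀⊆R = p─q⊆p R ⁅ r₀ ⁆
    inj′ : ∀ r r' → r ∈ R - r₀ → r' ∈ R - r₀ → f r ≡ f r' → r ≡ r'
    inj′ r r' r∈ r'∈ = inj r r' (R-r₀⊆R r∈) (R-r₀⊆R r'∈)
    into′ : ∀ {r} → r ∈ R - r₀ → f r ∈ˡ D
    into′ r∈ with into (R-r₀⊆R r∈)
    ... | here fr≡d = contradiction (inj _ r₀ (R-r₀⊆R r∈) r₀∈R (trans fr≡d (sym fr₀≡d)))
                                    (x∉⁅y⁆⇒x≢y (x∈p─q⇒x∉q R ⁅ r₀ ⁆ r∈))
    ... | there fr∈D = fr∈D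
... | no ∄r = ≤-trans (injection⇒∣p∣≤length _≟X_ f R D inj into′) (n≤1+n _)
  where
    into′ : ∀ {r} → r ∈ R → f r ∈ˡ D
    into′ r∈R with into r∈R
    ... | here fr≡d = contradiction (_ , r∈R , fr≡d) ∄r
    ... | there fr∈D = fr∈D

∣p∣≤#distinct-images : ∀ {k} {X : Set} (_≟X_ : DecidableEquality X) (f : Fin k → X) {R : Subset k} →
  (∀ r r' → r ∈ R → r' ∈ R → f r ≡ f r' → r ≡ r') → ∣ R ∣ ≤ length (deduplicate _≟X_ (map f (allFin k)))
∣p∣≤#distinct-images _≟X_ f inj =
  injection⇒∣p∣≤length _≟X_ f _ _ inj (λ {r} _ → ∈-deduplicate⁺ _≟X_ (∈-map⁺ f (∈-allFin r)))

∈⇒lookup-∩ : ∀ {k} {x : Fin k} {p : Subset k} (q : Subset k) → x ∈ p → Vec.lookup (p ∩ q) x ≡ Vec.lookup q x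
∈⇒lookup-∩ {x = x} {p} q x∈p =
  trans (lookup-zipWith _∧_ x p q) (cong (_∧ Vec.lookup q x) ([]=⇒lookup x∈p))

bit : Bool → ℕ
bit x = if x then 1 else 0

bit≤1 : ∀ x → bit x ≤ 1
bit≤1 true = s≤s z≤n
bit≤1 false = z≤n

bit-xor-triangle : ∀ x y x' y' → bit (x xor y) ≤ bit (x xor x') + bit (y xor y') + bit (x' xor y')
bit-xor-triangle true  true  _     _     = z≤n
bit-xor-triangle false false _     _     = z≤n
bit-xor-triangle true  false false _     = s≤s z≤n
bit-xor-triangle true  false true  true  = s≤s z≤n
bit-xor-triangle true  false true  false = s≤s z≤n
bit-xor-triangle false true  true  _     = s≤s z≤n
bit-xor-triangle false true  false false = s≤s z≤n
bit-xor-triangle false true  false true  = s≤s z≤n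

count : ∀ {A : Set} → (A → Bool) → List A → ℕ
count g [] = 0
count g (x ∷ xs) = bit (g x) + count g xs

count-drop≤count : ∀ {A : Set} (g : A → Bool) k xs → count g (drop k xs) ≤ count g xs
count-drop≤count g zero xs = ≤-refl
count-drop≤count g (suc k) [] = z≤n
count-drop≤count g (suc k) (x ∷ xs) = ≤-trans (count-drop≤count g k xs) (m≤n+m _ _)

length≡count-true : ∀ {A : Set} (xs : List A) → length xs ≡ count (λ _ → true) xs
length≡count-true [] = refl
length≡count-true (x ∷ xs) = cong suc (length≡count-true xs)

count≤∣p∣ : ∀ {k} (g : Fin k → Bool) (S : Subset k) {xs} → Unique xs →
  (∀ {x} → x ∈ˡ xs → g x ≡ true → x ∈ S) → count g xs ≤ ∣ S ∣
count≤∣p∣ g S {[]} _ _ = z≤n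
count≤∣p∣ g S {x ∷ xs} (x∉xs ∷ uxs) into with g x in gx
... | true = ≤-trans (s≤s (count≤∣p∣ g (S - x) uxs into′)) (x∈p⇒∣p-x∣<∣p∣ (into (here refl) gx))
  where
    into′ : ∀ {y} → y ∈ˡ xs → g y ≡ true → y ∈ S - x
    into′ y∈xs gy = x∈p∧x≢y⇒x∈p-y (into (there y∈xs) gy) (λ y≡x → All.lookup x∉xs y∈xs (sym y≡x))
... | false = count≤∣p∣ g S uxs (into ∘ there)

length≤∣p∣ : ∀ {k} (S : Subset k) {xs} → Unique xs → (∀ {x} → x ∈ˡ xs → x ∈ S) → length xs ≤ ∣ S ∣
length≤∣p∣ S {xs} uxs into =
  subst (_≤ ∣ S ∣) (sym (length≡count-true xs)) (count≤∣p∣ (λ _ → true) S uxs (λ x∈xs _ → into x∈xs))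

2^m≤2^n⇒m≤n : ∀ {x y} → 2 ^ x ≤ 2 ^ y → x ≤ y
2^m≤2^n⇒m≤n 2^x≤2^y = ≮⇒≥ (λ y<x → <⇒≱ (^-monoʳ-< 2 (s≤s (s≤s z≤n)) y<x) 2^x≤2^y)

2^m<2^n⇒m<n : ∀ {x y} → 2 ^ x < 2 ^ y → x < y
2^m<2^n⇒m<n 2^x<2^y = ≰⇒> (λ y≤x → <⇒≱ 2^x<2^y (^-monoʳ-≤ 2 y≤x))

N^k<2^x⇒k<x : ∀ {N k x} → 2 ≤ N → N ^ k < 2 ^ x → k < x
N^k<2^x⇒k<x {N} {k} 2≤N N^k<2^x = 2^m<2^n⇒m<n (≤-<-trans (^-monoˡ-≤ k 2≤N) N^k<2^x)

N^k≮2^x⇒N>0 : ∀ {N k x} → 0 < k → ¬ (N ^ k < 2 ^ x) → 0 < N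
N^k≮2^x⇒N>0 {zero} {suc k} {x} _ N^k≮2^x = contradiction (m^n>0 2 x) N^k≮2^x
N^k≮2^x⇒N>0 {suc N} _ _ = s≤s z≤n

scaled-≤-trans : ∀ {p q a k w} → q * a ≤ p * k → q * k ≤ p * w → a * (q * q) ≤ p * p * w
scaled-≤-trans {p} {q} {a} {k} {w} qa≤pk qk≤pw = begin
  a * (q * q)  ≡⟨ left a q ⟩
  q * (q * a)  ≤⟨ *-monoʳ-≤ q qa≤pk ⟩
  q * (p * k)  ≡⟨ middle q p k ⟩
  p * (q * k)  ≤⟨ *-monoʳ-≤ p qk≤pw ⟩
  p * (p * w)  ≡⟨ *-assoc p p w ⟨
  p * p * w    ∎
  where
    open ≤-Reasoning
    left : ∀ a q → a * (q * q) ≡ q * (q * a)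
    left = solve-∀
    middle : ∀ q p k → q * (p * k) ≡ p * (q * k)
    middle = solve-∀

-- With a = |Acur|·q² and P = p², a round takes a to a' < a/2 + P and runs only while a > 12P.
halving-step : ∀ {P a a'} r → 2 * a' < a + 2 * P → 12 * P < a → r ≡ 0 ⊎ (2 ^ suc r + 2) * P ≤ a' →
  (2 ^ suc (suc r) + 2) * P ≤ a
halving-step {P} _ _ 12P<a (inj₁ refl) = ≤-trans (*-monoˡ-≤ P (m≤m+n 6 6)) (<⇒≤ 12P<a)
halving-step {P} {a} {a'} r 2a'<a+2P _ (inj₂ bound) = <⇒≤ (+-cancelʳ-< (2 * P) _ a (begin-strict
  (2 ^ suc (suc r) + 2) * P + 2 * P  ≡⟨ double (2 ^ suc r) P ⟩
  2 * ((2 ^ suc r + 2) * P)          ≤⟨ *-monoʳ-≤ 2 bound ⟩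
  2 * a'                             <⟨ 2a'<a+2P ⟩
  a + 2 * P                          ∎))
  where
    open ≤-Reasoning
    double : ∀ x P → (2 * x + 2) * P + 2 * P ≡ 2 * ((x + 2) * P)
    double = solve-∀

-- x ≤ k (P/Q) log₂ N, written without logarithms as LoopCond and NearTwinOK do (there P = p²,
-- Q = q², so it reads x ≤ k c² log n). A record, so that its indices can be inferred.
record LogBounded (N P Q k x : ℕ) : Set where
  constructor log-bounded
  field 2^xQ≤N^kP : 2 ^ (x * Q) ≤ N ^ (k * P)

module _ {N P Q : ℕ} where

  LogBounded-≤ : ∀ {k x y} → y ≤ x → LogBounded N P Q k x → LogBounded N P Q k y
  LogBounded-≤ y≤x (log-bounded x-bound) = log-bounded (≤-trans (^-monoʳ-≤ 2 (*-monoˡ-≤ Q y≤x)) x-bound)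

  LogBounded-+ : ∀ {k l x y} → LogBounded N P Q k x → LogBounded N P Q l y → LogBounded N P Q (k + l) (x + y)
  LogBounded-+ {k} {l} {x} {y} (log-bounded x-bound) (log-bounded y-bound) = log-bounded (begin
    2 ^ ((x + y) * Q)          ≡⟨ cong (2 ^_) (*-distribʳ-+ Q x y) ⟩
    2 ^ (x * Q + y * Q)        ≡⟨ ^-distribˡ-+-* 2 (x * Q) (y * Q) ⟩
    2 ^ (x * Q) * 2 ^ (y * Q)  ≤⟨ *-mono-≤ x-bound y-bound ⟩
    N ^ (k * P) * N ^ (l * P)  ≡⟨ ^-distribˡ-+-* N (k * P) (l * P) ⟨
    N ^ (k * P + l * P)        ≡⟨ cong (N ^_) (*-distribʳ-+ P k l) ⟨
    N ^ ((k + l) * P)          ∎)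
    where open ≤-Reasoning

  LogBounded-⊔ : ∀ {k x y} → LogBounded N P Q k x → LogBounded N P Q k y → LogBounded N P Q k (x ⊔ y)
  LogBounded-⊔ {k} {x} {y} x-bound y-bound with ⊔-sel x y
  ... | inj₁ x⊔y≡x = subst (LogBounded N P Q k) (sym x⊔y≡x) x-bound
  ... | inj₂ x⊔y≡y = subst (LogBounded N P Q k) (sym x⊔y≡y) y-bound

  LogBounded-0 : ∀ {k} → 1 ≤ N → LogBounded N P Q k 0
  LogBounded-0 {k} 1≤N = log-bounded (subst (_≤ N ^ (k * P)) (^-zeroˡ (k * P)) (^-monoˡ-≤ (k * P) 1≤N))

-- If N ^ b < 2 ^ a, then t b < a because 2 ^ t ≤ N, whereas K a² ≤ Y b² ≤ t K b · b log N < t K b a.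
log²-bound-≥2 : ∀ {N K t Y} a b → 0 < K → 2 ^ t ≤ N → 2 ^ Y ≤ N ^ (t * K) →
  K * (a * a) ≤ Y * (b * b) → 2 ^ a ≤ N ^ b
log²-bound-≥2 {N} {K} {t} {Y} a b K>0 2^t≤N Y-bound a-bound with 2 ^ a ≤? N ^ b
... | yes 2^a≤N^b = 2^a≤N^b
... | no 2^a≰N^b = contradiction a≤tb (<⇒≱ tb<a)
  where
    open ≤-Reasoning
    N^b<2^a : N ^ b < 2 ^ a
    N^b<2^a = ≰⇒> 2^a≰N^b
    tb<a : t * b < a
    tb<a = 2^m<2^n⇒m<n (begin-strict
      2 ^ (t * b)  ≡⟨ ^-*-assoc 2 t b ⟨
      (2 ^ t) ^ b  ≤⟨ ^-monoˡ-≤ b 2^t≤N ⟩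
      N ^ b        <⟨ N^b<2^a ⟩
      2 ^ a        ∎)
    instance
      Ka≢0 : NonZero (K * a)
      Ka≢0 = >-nonZero (*-mono-≤ K>0 (≤-trans (s≤s z≤n) tb<a))
    a≤tb : a ≤ t * b
    a≤tb = *-cancelˡ-≤ (K * a) (2^m≤2^n⇒m≤n (begin
      2 ^ (K * a * a)          ≡⟨ cong (2 ^_) (*-assoc K a a) ⟩
      2 ^ (K * (a * a))        ≤⟨ ^-monoʳ-≤ 2 a-bound ⟩
      2 ^ (Y * (b * b))        ≡⟨ ^-*-assoc 2 Y (b * b) ⟨
      (2 ^ Y) ^ (b * b)        ≤⟨ ^-monoˡ-≤ (b * b) Y-bound ⟩
      (N ^ (t * K)) ^ (b * b)  ≡⟨ ^-*-assoc N (t * K) (b * b) ⟩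
      N ^ (t * K * (b * b))    ≡⟨ cong (N ^_) (N-exponent t K b) ⟩
      N ^ (b * (t * K * b))    ≡⟨ ^-*-assoc N b (t * K * b) ⟨
      (N ^ b) ^ (t * K * b)    ≤⟨ ^-monoˡ-≤ (t * K * b) (<⇒≤ N^b<2^a) ⟩
      (2 ^ a) ^ (t * K * b)    ≡⟨ ^-*-assoc 2 a (t * K * b) ⟩
      2 ^ (a * (t * K * b))    ≡⟨ cong (2 ^_) (2-exponent a t K b) ⟩
      2 ^ (K * a * (t * b))    ∎))
      where
        N-exponent : ∀ t K b → t * K * (b * b) ≡ b * (t * K * b)
        N-exponent = solve-∀
        2-exponent : ∀ a t K b → a * (t * K * b) ≡ K * a * (t * b)
        2-exponent = solve-∀

-- X ≤ t c (P/Q) log N and t ≤ log N give X ≤ c (P/Q) log² N, in the form of LogSqBound.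
log²-bound : ∀ {N P Q t c X} a b → 0 < c * P → 1 ≤ N → (2 ≤ N → 2 ^ t ≤ N) →
  LogBounded N P Q (t * c) X → c * P * (a * a) ≤ X * Q * (b * b) → 2 ^ a ≤ N ^ b
log²-bound {N = 1} zero b _ _ _ _ _ = ≤-reflexive (sym (^-zeroˡ b))
log²-bound {N = 1} {P} {Q} {t} {c} {X} (suc a) b cP>0 _ _ (log-bounded X-bound) a-bound =
  contradiction (≤-trans a-bound (≤-reflexive XQbb≡0)) (<⇒≱ (*-mono-≤ cP>0 (s≤s z≤n)))
  where
    XQ≡0 : X * Q ≡ 0
    XQ≡0 = n≤0⇒n≡0 (2^m≤2^n⇒m≤n (≤-trans X-bound (≤-reflexive (^-zeroˡ (t * c * P)))))
    XQbb≡0 : X * Q * (b * b) ≡ 0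
    XQbb≡0 = cong (_* (b * b)) XQ≡0
log²-bound {N = suc (suc N)} {P} {Q} {t} {c} {X} a b cP>0 _ 2^t≤N (log-bounded X-bound) a-bound =
  log²-bound-≥2 {t = t} {Y = X * Q} a b cP>0 (2^t≤N (s≤s (s≤s z≤n))) X-bound′ a-bound
  where
    X-bound′ : 2 ^ (X * Q) ≤ suc (suc N) ^ (t * (c * P))
    X-bound′ = subst (λ e → 2 ^ (X * Q) ≤ suc (suc N) ^ e) (*-assoc t c P) X-bound

-- Crossing numbers and the replayed order

module _ {n m : ℕ} (E : Graph n m) where

  separates : Fin m → Fin m → Fin n → Bool
  separates b b' a = E a b xor E a b'

  separates⇒∈symDiff : ∀ {a b b'} → separates b b' a ≡ true → a ∈ symDiff E (NB E b) (NB E b')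
  separates⇒∈symDiff {a} {b} {b'} a-separates = lookup⇒[]= a (symDiff E (NB E b) (NB E b')) (begin
    Vec.lookup (symDiff E (NB E b) (NB E b')) a        ≡⟨ lookup-zipWith _xor_ a (NB E b) (NB E b') ⟩
    Vec.lookup (NB E b) a xor Vec.lookup (NB E b') a   ≡⟨ cong₂ _xor_ (lookup∘tabulate _ a) (lookup∘tabulate _ a) ⟩
    separates b b' a                                   ≡⟨ a-separates ⟩
    true                                               ∎)
    where open ≡-Reasoning

  twins-agree : ∀ {B' : Subset m} {v r b'} → TwinA E B' v r → b' ∈ B' → E v b' ≡ E r b'
  twins-agree {B'} {v} {r} {b'} twins b'∈B' = begin
    E v b'                       ≡⟨ lookup∘tabulate (E v) b' ⟨
    Vec.lookup (NA E v) b'       ≡⟨ ∈⇒lookup-∩ (NA E v) b'∈B' ⟨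
    Vec.lookup (B' ∩ NA E v) b'  ≡⟨ cong (λ s → Vec.lookup s b') twins ⟩
    Vec.lookup (B' ∩ NA E r) b'  ≡⟨ ∈⇒lookup-∩ (NA E r) b'∈B' ⟩
    Vec.lookup (NA E r) b'       ≡⟨ lookup∘tabulate (E r) b' ⟩
    E r b'                       ∎
    where open ≡-Reasoning

  crossB≤length : ∀ O b → crossB E O b ≤ length O
  crossB≤length [] b = z≤n
  crossB≤length (a ∷ []) b = z≤n
  crossB≤length (a ∷ a' ∷ as) b = +-mono-≤ (bit≤1 _) (crossB≤length (a' ∷ as) b)

  crossB≤crossB+count : ∀ b b' O →
    crossB E O b ≤ crossB E O b' + (count (separates b b') O + count (separates b b') (drop 1 O))
  crossB≤crossB+count b b' [] = z≤n
  crossB≤crossB+count b b' (a ∷ []) = z≤n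
  crossB≤crossB+count b b' (a ∷ a' ∷ as) = begin
    X + C                                   ≤⟨ +-mono-≤ (bit-xor-triangle (E a b) (E a' b) (E a b') (E a' b'))
                                                        (crossB≤crossB+count b b' (a' ∷ as)) ⟩
    (δ + δ' + X') + (C' + ((δ' + K) + K))   ≡⟨ regroup δ δ' X' C' K ⟩
    (X' + C') + ((δ + (δ' + K)) + (δ' + K)) ∎
    where
      open ≤-Reasoning
      X = bit (E a b xor E a' b)
      X' = bit (E a b' xor E a' b')
      C = crossB E (a' ∷ as) b
      C' = crossB E (a' ∷ as) b'
      δ = bit (separates b b' a)
      δ' = bit (separates b b' a')
      K = count (separates b b') as
      regroup : ∀ δ δ' X' C' K →
        (δ + δ' + X') + (C' + ((δ' + K) + K)) ≡ (X' + C') + ((δ + (δ' + K)) + (δ' + K))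
      regroup = solve-∀

  crossB-near-twins : ∀ {S : Subset n} {O} b b' → Unique O → (∀ {a} → a ∈ˡ O → a ∈ S) →
    let d = ∣ S ∩ symDiff E (NB E b) (NB E b') ∣ in crossB E O b ≤ d + d + crossB E O b'
  crossB-near-twins {S} {O} b b' uO O⊆S = begin
    crossB E O b                                        ≤⟨ crossB≤crossB+count b b' O ⟩
    crossB E O b' + (count sep O + count sep (drop 1 O)) ≤⟨ +-monoʳ-≤ (crossB E O b') counts≤d+d ⟩
    crossB E O b' + (d + d)                             ≡⟨ +-comm (crossB E O b') (d + d) ⟩
    d + d + crossB E O b'                               ∎
    where
      open ≤-Reasoning
      sep = separates b b'
      d = ∣ S ∩ symDiff E (NB E b) (NB E b') ∣
      count≤d : count sep O ≤ d
      count≤d = count≤∣p∣ sep _ uO (λ a∈O a-separates → x∈p∩q⁺ (O⊆S a∈O , separates⇒∈symDiff a-separates))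
      counts≤d+d : count sep O + count sep (drop 1 O) ≤ d + d
      counts≤d+d = +-mono-≤ count≤d (≤-trans (count-drop≤count sep 1 O) count≤d)

  crossB-replace-head : ∀ {u w b} → E u b ≡ E w b → ∀ xs → crossB E (u ∷ xs) b ≡ crossB E (w ∷ xs) b
  crossB-replace-head u~w [] = refl
  crossB-replace-head {b = b} u~w (y ∷ ys) = cong (λ e → bit (e xor E y b) + crossB E (y ∷ ys) b) u~w

  module _ {v r : Fin n} {b : Fin m} (v~r : E v b ≡ E r b) where

    crossB-skip-agreeing : ∀ xs → crossB E (r ∷ v ∷ xs) b ≡ crossB E (r ∷ xs) b
    crossB-skip-agreeing xs = begin
      bit (E r b xor E v b) + crossB E (v ∷ xs) b  ≡⟨ cong (λ e → bit (E r b xor e) + crossB E (v ∷ xs) b) v~r ⟩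
      bit (E r b xor E r b) + crossB E (v ∷ xs) b  ≡⟨ cong (λ e → bit e + crossB E (v ∷ xs) b) (xor-same (E r b)) ⟩
      crossB E (v ∷ xs) b                          ≡⟨ crossB-replace-head v~r xs ⟩
      crossB E (r ∷ xs) b                          ∎
      where open ≡-Reasoning

    crossB-∷-insertAfter : ∀ x O → crossB E (x ∷ insertAfter E v r O) b ≡ crossB E (x ∷ O) b
    crossB-∷-insertAfter x [] = refl
    crossB-∷-insertAfter x (y ∷ ys) with y ≟ r
    ... | yes refl = cong (bit (E x b xor E y b) +_) (crossB-skip-agreeing ys)
    ... | no _ = cong (bit (E x b xor E y b) +_) (crossB-∷-insertAfter y ys)

    crossB-insertAfter : ∀ O → crossB E (insertAfter E v r O) b ≡ crossB E O b
    crossB-insertAfter [] = refl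
    crossB-insertAfter (y ∷ ys) with y ≟ r
    ... | yes refl = crossB-skip-agreeing ys
    ... | no _ = crossB-∷-insertAfter y ys

  insertAfter-↭ : ∀ {v r O} → r ∈ˡ O → insertAfter E v r O ↭ v ∷ O
  insertAfter-↭ {v} {r} {y ∷ ys} r∈O with y ≟ r | r∈O
  ... | yes _ | _ = swap y v ↭-refl
  ... | no y≢r | here r≡y = contradiction (sym r≡y) y≢r
  ... | no _ | there r∈ys = ↭-trans (prep y (insertAfter-↭ r∈ys)) (swap y v ↭-refl)

  insertAll : List (Fin n × Fin n) → List (Fin n) → List (Fin n)
  insertAll P O = foldr (λ vr → insertAfter E (proj₁ vr) (proj₂ vr)) O P

  replay : List (Fin n) → List (Fin n × Fin n) → List (Fin n)
  replay = foldl (λ O vr → insertAfter E (proj₁ vr) (proj₂ vr) O)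

  replay-reverse : ∀ O P → replay O (reverse P) ≡ insertAll P O
  replay-reverse O P = begin
    replay O (reverse P)             ≡⟨ reverse-foldr _ O (reverse P) ⟨
    foldr _ O (reverse (reverse P))  ≡⟨ cong (foldr _ O) (reverse-involutive P) ⟩
    insertAll P O                    ∎
    where open ≡-Reasoning

  insertAll-↭ : ∀ {O} P → (∀ {v r} → (v , r) ∈ˡ P → r ∈ˡ O) → insertAll P O ↭ map proj₁ P ++ O
  insertAll-↭ [] _ = ↭-refl
  insertAll-↭ {O} ((v , r) ∷ P) reps∈O = ↭-trans (insertAfter-↭ r∈) (prep v P↭)
    where
      P↭ = insertAll-↭ P (reps∈O ∘ there)
      r∈ : r ∈ˡ insertAll P O
      r∈ = ∈-resp-↭ (↭-sym P↭) (∈-++⁺ʳ (map proj₁ P) (reps∈O (here refl)))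

  crossB-insertAll : ∀ {b} O P → (∀ {v r} → (v , r) ∈ˡ P → E v b ≡ E r b) →
    crossB E (insertAll P O) b ≡ crossB E O b
  crossB-insertAll O [] _ = refl
  crossB-insertAll O ((v , r) ∷ P) agree =
    trans (crossB-insertAfter (agree (here refl)) (insertAll P O)) (crossB-insertAll O P (agree ∘ there))

  Enumerates-resp-↭ : ∀ {S xs ys} → xs ↭ ys → Enumerates E S xs → Enumerates E S ys
  Enumerates-resp-↭ xs↭ys (uxs , mem) =
    Perm.Unique-resp-↭ (setoid (Fin n)) (↭⇒↭ₛ xs↭ys) uxs ,
    λ v → ∈-resp-↭ xs↭ys ∘ proj₁ (mem v) , proj₂ (mem v) ∘ ∈-resp-↭ (↭-sym xs↭ys)

  Enumerates-++ : ∀ {S T xs ys} → T ⊆ S → Enumerates E (S ─ T) xs → Enumerates E T ys →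
    Enumerates E S (xs ++ ys)
  Enumerates-++ {S} {T} {xs} {ys} T⊆S (uxs , memxs) (uys , memys) =
    Unique.++⁺ uxs uys (λ (v∈xs , v∈ys) → x∈p─q⇒x∉q S T (proj₂ (memxs _) v∈xs) (proj₂ (memys _) v∈ys)) ,
    λ v → to v , from v
    where
      to : ∀ v → v ∈ S → v ∈ˡ xs ++ ys
      to v v∈S with v ∈? T
      ... | yes v∈T = ∈-++⁺ʳ xs (proj₁ (memys v) v∈T)
      ... | no v∉T = ∈-++⁺ˡ (proj₁ (memxs v) (x∈p∧x∉q⇒x∈p─q v∈S v∉T))
      from : ∀ v → v ∈ˡ xs ++ ys → v ∈ S
      from v v∈ with ∈-++⁻ xs v∈
      ... | inj₁ v∈xs = p─q⊆p S T (proj₂ (memxs v) v∈xs)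
      ... | inj₂ v∈ys = T⊆S (proj₂ (memys v) v∈ys)

  insertAll-enumerates : ∀ {Acur B' A' P O} → A' ⊆ Acur → PushedOK E Acur B' A' P → Enumerates E A' O →
    Enumerates E Acur (insertAll P O)
  insertAll-enumerates {P = P} A'⊆Acur (pushed , reps) enumO =
    Enumerates-resp-↭ (↭-sym (insertAll-↭ P (λ vr∈P → proj₁ (proj₂ enumO _) (proj₁ (reps _ _ vr∈P)))))
                      (Enumerates-++ A'⊆Acur pushed enumO)

  crossingNumber-bound : ∀ {N P Q k O} → 1 ≤ N → (∀ b → LogBounded N P Q k (crossB E O b)) →
    LogBounded N P Q k (crossingNumber E O)
  crossingNumber-bound {N} {P} {Q} {k} 1≤N bounded =
    foldr-preservesᵇ {P = LogBounded N P Q k} LogBounded-⊔ (LogBounded-0 1≤N)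
                     (All.map⁺ (All.universal bounded (allFin m)))

  ∣B'∣≤twinClassesB : ∀ {W Bcur B'} → IsReps E (TwinB E W) Bcur B' → ∣ B' ∣ ≤ twinClassesB E W
  ∣B'∣≤twinClassesB {W} (_ , _ , distinct) = ∣p∣≤#distinct-images (≡-dec _≟ᵇ_) (λ b → W ∩ NB E b) distinct

  ∣A'∣≤twinClassesA : ∀ {B' Acur A'} → IsReps E (TwinA E B') Acur A' → ∣ A' ∣ ≤ twinClassesA E B'
  ∣A'∣≤twinClassesA {B'} (_ , _ , distinct) = ∣p∣≤#distinct-images (≡-dec _≟ᵇ_) (λ a → B' ∩ NA E a) distinct

  *-ceilDiv< : ∀ x d → 0 < d → d * ceilDiv E x d < x + d
  *-ceilDiv< x (suc y) _ = begin-strict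
    suc y * ((x + y) / suc y)  ≡⟨ *-comm (suc y) _ ⟩
    ((x + y) / suc y) * suc y  ≤⟨ m/n*n≤m (x + y) (suc y) ⟩
    x + y                      <⟨ +-monoʳ-< x (n<1+n y) ⟩
    x + suc y                  ∎
    where open ≤-Reasoning

  ceilDiv>0 : ∀ x d → 0 < d → 0 < x → 0 < ceilDiv E x d
  ceilDiv>0 x (suc y) _ x>0 = m≥n⇒m/n>0 (+-monoˡ-≤ y x>0)

-- Runs of Algorithm 1

module _ {n m : ℕ} (E : Graph n m) (p q : ℕ) where

  LinBound⇒p>0 : LinBound E p q → 0 < p
  LinBound⇒p>0 (q>0 , q≤p , _) = ≤-trans q>0 q≤p

  p>0⇒12p²>0 : 0 < p → 0 < 12 * (p * p)
  p>0⇒12p²>0 p>0 = *-mono-≤ {1} {12} (s≤s z≤n) (*-mono-≤ p>0 p>0)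

  loop⇒12p²<∣Acur∣q² : ∀ {Acur} → 2 ≤ n → LoopCond E p q Acur → 12 * (p * p) < ∣ Acur ∣ * (q * q)
  loop⇒12p²<∣Acur∣q² {Acur} 2≤n loop = N^k<2^x⇒k<x {n} {12 * (p * p)} {∣ Acur ∣ * (q * q)} 2≤n loop

  rounds : ∀ {Acur Bcur L out} → Run E p q Acur Bcur L out → ℕ
  rounds (finish _ _ _) = 0
  rounds (fail _ _ _ _ _ _ _ _ _) = 0
  rounds (step _ _ _ _ _ _ _ _ _ _ _ run) = suc (rounds run)

  order⇒n>0 : ∀ {Acur Bcur L O} → 0 < p → Run E p q Acur Bcur L (order O) → 0 < n
  order⇒n>0 {Acur} p>0 (finish _ ¬loop _) = N^k≮2^x⇒N>0 {x = ∣ Acur ∣ * (q * q)} (p>0⇒12p²>0 p>0) ¬loop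
  order⇒n>0 p>0 (step _ _ _ _ _ _ _ _ _ _ _ run) = order⇒n>0 p>0 run

  step-crossing : ∀ {Acur Bcur W B' A' P O k} → IsReps E (TwinB E W) Bcur B' →
    NearTwinOK E p q Acur Bcur W B' → PushedOK E Acur B' A' P → Enumerates E Acur (insertAll E P O) →
    (∀ {b'} → b' ∈ B' → LogBounded n (p * p) (q * q) k (crossB E O b')) →
    ∀ {b} → b ∈ Bcur → LogBounded n (p * p) (q * q) (12 + k) (crossB E (insertAll E P O) b)
  step-crossing {Acur} {P = P} {O} (_ , represented , _) near-twins (_ , reps) (unique , mem) O-bounded {b} b∈Bcur
    with represented b b∈Bcur
  ... | b' , b'∈B' , twins = LogBounded-≤ near (LogBounded-+ (LogBounded-+ d-bound d-bound) (O-bounded b'∈B'))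
    where
      d = ∣ Acur ∩ symDiff E (NB E b) (NB E b') ∣
      d-bound : LogBounded n (p * p) (q * q) 6 d
      d-bound = log-bounded (near-twins b b' b∈Bcur b'∈B' twins)
      same-crossing : crossB E (insertAll E P O) b' ≡ crossB E O b'
      same-crossing = crossB-insertAll E O P (λ vr∈P → twins-agree E (proj₂ (reps _ _ vr∈P)) b'∈B')
      near : crossB E (insertAll E P O) b ≤ d + d + crossB E O b'
      near = ≤-trans (crossB-near-twins E b b' unique (proj₂ (mem _)))
                     (≤-reflexive (cong (d + d +_) same-crossing))

  built-order : ∀ {Acur Bcur L O} (run : Run E p q Acur Bcur L (order O)) →
    Σ (List (Fin n)) λ O₀ → O ≡ replay E O₀ L × Enumerates E Acur O₀ ×
      (∀ {b} → b ∈ Bcur → LogBounded n (p * p) (q * q) (suc (rounds run) * 12) (crossB E O₀ b))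
  built-order {Acur} (finish O₀ ¬loop enum) =
    O₀ , refl , enum , λ {b} _ → LogBounded-≤ (crossB≤∣Acur∣ b) Acur-bound
    where
      crossB≤∣Acur∣ : ∀ b → crossB E O₀ b ≤ ∣ Acur ∣
      crossB≤∣Acur∣ b = ≤-trans (crossB≤length E O₀ b) (length≤∣p∣ Acur (proj₁ enum) (proj₂ (proj₂ enum _)))
      Acur-bound : LogBounded n (p * p) (q * q) 12 ∣ Acur ∣
      Acur-bound = log-bounded (≮⇒≥ ¬loop)
  built-order {L = L} (step W B' A' P _ _ _ repsB (A'⊆Acur , _) near-twins pushed run) with built-order run
  ... | O₀ , O≡ , enum , bounded =
    insertAll E P O₀ , O≡′ , enum′ , step-crossing repsB near-twins pushed enum′ bounded
    where
      enum′ = insertAll-enumerates E A'⊆Acur pushed enum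
      O≡′ = trans O≡ (trans (foldl-++ _ O₀ (reverse P) L) (cong (λ O → replay E O L) (replay-reverse E O₀ P)))

  module _ (linear : LinBound E p q) where

    private
      q≤p = proj₁ (proj₂ linear)
      π-bounds = proj₂ (proj₂ linear)
      p*p>0 : 0 < p * p
      p*p>0 = let p>0 = LinBound⇒p>0 linear in *-mono-≤ p>0 p>0

    -- B' may be empty, and linearity only bounds twin classes of nonempty sets: hence ∣ B' ∣ ⊔ 1.
    representatives-shrink : ∀ {Acur Bcur W B' A'} → 1 ≤ ∣ W ∣ →
      IsReps E (TwinB E W) Bcur B' → IsReps E (TwinA E B') Acur A' → ∣ A' ∣ * (q * q) ≤ p * p * ∣ W ∣
    representatives-shrink {W = W} {B'} {A'} W≥1 repsB repsA =
      scaled-≤-trans {p} {q} {∣ A' ∣} {∣ B' ∣ ⊔ 1} {∣ W ∣} qA'≤pk qk≤pW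
      where
        qA'≤pk : q * ∣ A' ∣ ≤ p * (∣ B' ∣ ⊔ 1)
        qA'≤pk = ≤-trans (*-monoʳ-≤ q (∣A'∣≤twinClassesA E repsA)) (proj₂ (π-bounds _ (m≤n⊔m _ 1)) B' (m≤m⊔n _ 1))
        qB'≤pW : q * ∣ B' ∣ ≤ p * ∣ W ∣
        qB'≤pW = ≤-trans (*-monoʳ-≤ q (∣B'∣≤twinClassesB E repsB)) (proj₁ (π-bounds _ W≥1) W ≤-refl)
        qk≤pW : q * (∣ B' ∣ ⊔ 1) ≤ p * ∣ W ∣
        qk≤pW = subst (_≤ p * ∣ W ∣) (sym (*-distribˡ-⊔ q ∣ B' ∣ 1)) (⊔-lub qB'≤pW (*-mono-≤ q≤p W≥1))

    round-halves : ∀ {Acur Bcur W B' A'} → 2 ≤ n → LoopCond E p q Acur →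
      ∣ W ∣ ≡ ceilDiv E (∣ Acur ∣ * (q * q)) (2 * (p * p)) →
      IsReps E (TwinB E W) Bcur B' → IsReps E (TwinA E B') Acur A' →
      2 * (∣ A' ∣ * (q * q)) < ∣ Acur ∣ * (q * q) + 2 * (p * p)
    round-halves {Acur} {W = W} {A' = A'} 2≤n loop ∣W∣≡ repsB repsA = begin-strict
      2 * (∣ A' ∣ * (q * q))           ≤⟨ *-monoʳ-≤ 2 (representatives-shrink W≥1 repsB repsA) ⟩
      2 * (p * p * ∣ W ∣)              ≡⟨ *-assoc 2 (p * p) ∣ W ∣ ⟨
      2 * (p * p) * ∣ W ∣              ≡⟨ cong (2 * (p * p) *_) ∣W∣≡ ⟩
      2 * (p * p) * ceilDiv E sQ 2P    <⟨ *-ceilDiv< E sQ 2P 2P>0 ⟩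
      sQ + 2P                          ∎
      where
        open ≤-Reasoning
        sQ = ∣ Acur ∣ * (q * q)
        2P = 2 * (p * p)
        2P>0 : 0 < 2P
        2P>0 = *-mono-≤ {1} {2} (s≤s z≤n) p*p>0
        W≥1 : 1 ≤ ∣ W ∣
        W≥1 = subst (0 <_) (sym ∣W∣≡)
                    (ceilDiv>0 E sQ 2P 2P>0 (≤-trans (s≤s z≤n) (loop⇒12p²<∣Acur∣q² {Acur} 2≤n loop)))

    halving : ∀ {Acur Bcur L out} (run : Run E p q Acur Bcur L out) → 2 ≤ n →
      rounds run ≡ 0 ⊎ (2 ^ suc (rounds run) + 2) * (p * p) ≤ ∣ Acur ∣ * (q * q)
    halving (finish _ _ _) _ = inj₁ refl
    halving (fail _ _ _ _ _ _ _ _ _) _ = inj₁ refl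
    halving {Acur} (step _ _ _ _ loop _ ∣W∣≡ repsB repsA _ _ run) 2≤n =
      inj₂ (halving-step (rounds run) (round-halves 2≤n loop ∣W∣≡ repsB repsA)
                         (loop⇒12p²<∣Acur∣q² {Acur} 2≤n loop) (halving run 2≤n))

    2^rounds≤n : ∀ {Bcur L out} (run : Run E p q ⊤ Bcur L out) → 2 ≤ n → 2 ^ suc (rounds run) ≤ n
    2^rounds≤n run 2≤n with halving run 2≤n
    ... | inj₁ r≡0 = subst (λ r → 2 ^ suc r ≤ n) (sym r≡0) 2≤n
    ... | inj₂ bound = *-cancelʳ-≤ _ n (p * p) {{>-nonZero p*p>0}} (begin
      2 ^ t * (p * p)        ≤⟨ *-monoˡ-≤ (p * p) (m≤m+n (2 ^ t) 2) ⟩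
      (2 ^ t + 2) * (p * p)  ≤⟨ bound ⟩
      ∣ ⊤ {n} ∣ * (q * q)    ≡⟨ cong (_* (q * q)) (∣⊤∣≡n n) ⟩
      n * (q * q)            ≤⟨ *-monoʳ-≤ n (*-mono-≤ q≤p q≤p) ⟩
      n * (p * p)            ∎)
      where
        open ≤-Reasoning
        t = suc (rounds run)

theorem10 : ∀ (n m : ℕ) (E : Graph n m) (p q : ℕ) → HasLinearity E p q →
  ∀ (out : Output E) → Run E p q ⊤ ⊤ [] out →
  out ≡ false' ⊎
  Σ (List (Fin n)) (λ O → out ≡ order O × Enumerates E ⊤ O × LogSqBound E p q (crossingNumber E O))
theorem10 n m E p q _ false' _ = inj₁ refl
theorem10 n m E p q (linear , _) (order O) run with built-order E p q run
... | O₀ , refl , enumerates , bounded = inj₂ (O₀ , refl , enumerates , λ a b _ →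
  log²-bound {P = p * p} {Q = q * q} {t} {12} a b 12p²>0 n>0 (2^rounds≤n E p q linear run) crossing-bound)
  where
    t = suc (rounds E p q run)
    p>0 = LinBound⇒p>0 E p q linear
    12p²>0 = p>0⇒12p²>0 E p q p>0
    n>0 = order⇒n>0 E p q p>0 run
    crossing-bound : LogBounded n (p * p) (q * q) (t * 12) (crossingNumber E O₀)
    crossing-bound = crossingNumber-bound E {O = O₀} n>0 (λ _ → bounded ∈⊤)
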